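{- Let $t$ be the Thue–Morse word, the fixed point starting with $a$ of the morphism $a\mapsto abba$, $b\mapsto baab$, and let $SP_t(k)$ be the smallest $n$ such that $PPL_t(n)=k$. Writing numbers in base $4$, we have $SP_t(3k+2)=((12)^k2)_4$ for all $k\ge 0$; $SP_t(3k)=(1(12)^{k-1}2)_4$ for all $k\ge 1$; and $SP_t(3k+1)=(2(12)^{k-1}2)_4$ for all $k\ge 1$.
   Context: $PPL_t(n)$ is the minimal number of palindromes whose concatenation is the prefix of $t$ of length $n$. $(w)_4$ denotes the integer whose base-4 representation is the digit string $w$, and $(12)^k$ denotes the string $12$ repeated $k$ times. -}

module Defs where

open import Data.Nat using (ℕ; zero; suc; _+_; _*_; _≤_; _<_)
open import Data.List using (List; []; _∷_; _++_; concat; concatMap; reverse; length; map; upTo; replicate; foldl; lookup)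
open import Data.List.Relation.Unary.All using (All)
open import Data.Product using (Σ; _×_; _,_)
open import Data.Fin using (Fin; fromℕ<)
open import Relation.Binary.PropositionalEquality using (_≡_)
open import Relation.Nullary using (¬_)

data Letter : Set where
  a b : Letter

σ : Letter → List Letter
σ a = a ∷ b ∷ b ∷ a ∷ []
σ b = b ∷ a ∷ a ∷ b ∷ []

σ* : List Letter → List Letter
σ* = concatMap σ

σ^ : ℕ → List Letter
σ^ zero = a ∷ []
σ^ (suc m) = σ* (σ^ m)

lookupD : Letter → List Letter → ℕ → Letter
lookupD d [] _ = d
lookupD d (x ∷ xs) zero = x
lookupD d (x ∷ xs) (suc n) = lookupD d xs n

-- the Thue–Morse word t (fixed point of σ starting with a):
-- t(n) is the n-th letter (0-indexed) of σ^(n+1)(a), which has length 4^(n+1) > n,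
-- so the default letter is never used.
t : ℕ → Letter
t n = lookupD a (σ^ (suc n)) n

prefix : ℕ → List Letter
prefix n = map t (upTo n)

IsPalindrome : List Letter → Set
IsPalindrome w = (1 ≤ length w) × (reverse w ≡ w)

PalFact : ℕ → List Letter → Set
PalFact k w = Σ (List (List Letter)) λ ps →
  (length ps ≡ k) × (All IsPalindrome ps × (concat ps ≡ w))

PPL : ℕ → ℕ → Set
PPL n k = PalFact k (prefix n) × (∀ j → PalFact j (prefix n) → k ≤ j)

SP : ℕ → ℕ → Set
SP k n = PPL n k × (∀ m → m < n → ¬ PPL m k)

base4 : List ℕ → ℕ
base4 = foldl (λ acc d → 4 * acc + d) 0

rep12 : ℕ → List ℕ
rep12 k = concat (replicate k (1 ∷ 2 ∷ []))

-- Let ppl be the function with ppl 0 = 0 and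
--   ppl (4q) = ppl q,  ppl (4q+1) = ppl q + 1,  ppl (4q+2) = 2 + min (ppl q) (ppl (q+1)),  ppl (4q+3) = ppl (q+1) + 1.
-- It bounds PPL_t from above because σ maps a factorisation of t[0..q) into palindromes to one of
-- t[0..4q), and the σ-image of a last factor t[m..q+1) stays a palindrome when trimmed to end at
-- 4q+2 or 4q+3. It bounds PPL_t from below because appending a palindrome t[i..n) raises ppl by at
-- most one: an odd palindrome of t has length 1 or 3, and an even one is centred between positions
-- c - 1 and c with c even (as t(2m) ≠ t(2m+1)), so i + n is a multiple of 4 and the palindrome
-- desubstitutes to a palindrome t[u..v) with 4u ≤ i ≤ 4u + 3, to which induction applies.
-- Hence PPL_t = ppl. Since ppl (n+1) ≤ ppl n + 1, the least n with ppl n = j + 2 is 2 + 4 spPair j,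
-- where spPair j, the least n with j ≤ min (ppl n) (ppl (n+1)), satisfies
-- spPair (j+3) = 16 spPair j + 6; in base 4 this appends the digits 12.

module Submission where

open import Defs
open import Data.Nat
open import Data.Nat.Properties
open import Data.List using (List; []; _∷_; _++_; [_]; length; map; reverse; concat; applyUpTo; foldl)
open import Data.List.Relation.Unary.All using (All; []; _∷_)
open import Data.List.Relation.Unary.All.Properties using (++⁺)
open import Data.List.Properties using (++-assoc; ++-identityʳ; ∷-injective; reverse-++; length-++; concat-++; foldl-++)
open import Data.Product using (Σ; ∃; _×_; _,_; proj₁; proj₂; map₁)
open import Data.Sum using (_⊎_; inj₁; inj₂)
open import Data.Empty using (⊥-elim)
open import Function using (_∘_)
open import Data.Nat.Induction using (<-rec)
open import Data.Nat.Tactic.RingSolver using (solve-∀)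
open import Relation.Binary.PropositionalEquality hiding ([_])
open import Relation.Binary.Definitions using (Tri; tri<; tri≈; tri>)
open import Relation.Nullary using (¬_)

0<4 : 0 < 4
0<4 = s≤s z≤n

1<4 : 1 < 4
1<4 = s≤s (s≤s z≤n)

2<4 : 2 < 4
2<4 = s≤s (s≤s (s≤s z≤n))

3<4 : 3 < 4
3<4 = s≤s (s≤s (s≤s (s≤s z≤n)))

data LastDigit : ℕ → Set where
  ends0 : ∀ q → LastDigit (q * 4)
  ends1 : ∀ q → LastDigit (1 + q * 4)
  ends2 : ∀ q → LastDigit (2 + q * 4)
  ends3 : ∀ q → LastDigit (3 + q * 4)

lastDigit : ∀ n → LastDigit n
lastDigit 0 = ends0 0
lastDigit 1 = ends1 0
lastDigit 2 = ends2 0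
lastDigit 3 = ends3 0
lastDigit (suc (suc (suc (suc n)))) with lastDigit n
... | ends0 q = ends0 (suc q)
... | ends1 q = ends1 (suc q)
... | ends2 q = ends2 (suc q)
... | ends3 q = ends3 (suc q)

q<1+q*4 : ∀ q → q < 1 + q * 4
q<1+q*4 q = s≤s (m≤m*n q 4)

q<2+q*4 : ∀ q → q < 2 + q * 4
q<2+q*4 q = m≤n⇒m≤1+n (q<1+q*4 q)

1+q<2+q*4 : ∀ q → suc q < 2 + q * 4
1+q<2+q*4 q = s≤s (q<1+q*4 q)

1+q<3+q*4 : ∀ q → suc q < 3 + q * 4
1+q<3+q*4 q = m≤n⇒m≤1+n (1+q<2+q*4 q)

1+q<4+q*4 : ∀ q → suc q < suc q * 4
1+q<4+q*4 q = m≤n⇒m≤1+n (1+q<3+q*4 q)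

digits : ∀ p → Σ ℕ λ r → Σ ℕ λ q → r < 4 × p ≡ r + q * 4
digits p with lastDigit p
... | ends0 q = 0 , q , 0<4 , refl
... | ends1 q = 1 , q , 1<4 , refl
... | ends2 q = 2 , q , 2<4 , refl
... | ends3 q = 3 , q , 3<4 , refl

digits-mono-≤ : ∀ {c d x q} → c ≤ d → x ≤ q → c + x * 4 ≤ d + q * 4
digits-mono-≤ c≤d x≤q = +-mono-≤ c≤d (*-monoˡ-≤ 4 x≤q)

digits-carry-≤ : ∀ {c d x q} → c ≤ 4 + d → x < q → c + x * 4 ≤ d + q * 4
digits-carry-≤ {c} {d} {x} {q} c≤4+d x<q = begin
  c + x * 4        ≤⟨ +-monoˡ-≤ (x * 4) c≤4+d ⟩
  4 + d + x * 4    ≡⟨ cong (_+ x * 4) (+-comm 4 d) ⟩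
  d + 4 + x * 4    ≡⟨ +-assoc d 4 (x * 4) ⟩
  d + suc x * 4    ≤⟨ +-monoʳ-≤ d (*-monoˡ-≤ 4 x<q) ⟩
  d + q * 4        ∎
  where open ≤-Reasoning

quot-mono-≤ : ∀ {c d x y} → d < 4 → c + x * 4 ≤ d + y * 4 → x ≤ y
quot-mono-≤ {c} d<4 h = ≮⇒≥ (λ y<x → ≤⇒≯ h (digits-carry-≤ (≤-trans d<4 (m≤m+n 4 c)) y<x))

quot-mono-< : ∀ {c d x y} → d ≤ c → c + x * 4 < d + y * 4 → x < y
quot-mono-< d≤c h = ≰⇒> (λ y≤x → <⇒≱ h (digits-mono-≤ d≤c y≤x))

base4-carry : ∀ {r r' Q S} → r < 4 → r' < 4 → (r + r' + 1) + Q * 4 ≡ S * 4 → r + r' ≡ 3 × suc Q ≡ S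
base4-carry {r} {r'} {Q} {S} r<4 r'<4 e = r+r'≡3 , 1+Q≡S
  where
  1+Q≤S : suc Q ≤ S
  1+Q≤S = quot-mono-≤ {c = 0} 3<4 (begin
    4 + Q * 4                ≤⟨ +-monoˡ-≤ (Q * 4) (+-monoʳ-≤ 3 (m≤n+m 1 (r + r'))) ⟩
    3 + (r + r' + 1) + Q * 4 ≡⟨ +-assoc 3 (r + r' + 1) (Q * 4) ⟩
    3 + (r + r' + 1 + Q * 4) ≡⟨ cong (3 +_) e ⟩
    3 + S * 4                ∎)
    where open ≤-Reasoning
  S≤1+Q : S ≤ suc Q
  S≤1+Q = quot-mono-≤ {c = 0} 3<4 (begin
    S * 4                ≡⟨ e ⟨
    r + r' + 1 + Q * 4   ≤⟨ +-monoˡ-≤ (Q * 4) (+-monoˡ-≤ 1 (+-mono-≤ (≤-pred r<4) (≤-pred r'<4))) ⟩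
    3 + suc Q * 4        ∎)
    where open ≤-Reasoning
  1+Q≡S : suc Q ≡ S
  1+Q≡S = ≤-antisym 1+Q≤S S≤1+Q
  r+r'≡3 : r + r' ≡ 3
  r+r'≡3 = suc-injective (trans (+-comm 1 (r + r'))
    (+-cancelʳ-≡ (Q * 4) (r + r' + 1) 4 (trans e (cong (_* 4) (sym 1+Q≡S)))))

even-or-odd : ∀ o → ∃ λ k → o ≡ k * 2 ⊎ o ≡ suc (k * 2)
even-or-odd zero = 0 , inj₁ refl
even-or-odd (suc o) with even-or-odd o
... | k , inj₁ refl = k , inj₂ refl
... | k , inj₂ refl = suc k , inj₁ refl

parity-+-even : ∀ x k → parity (x + k * 2) ≡ parity x
parity-+-even x zero = cong parity (+-identityʳ x)
parity-+-even x (suc k) = begin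
  parity (x + (2 + k * 2))        ≡⟨ cong parity (+-suc x (suc (k * 2))) ⟩
  parity (suc (x + suc (k * 2)))  ≡⟨ cong (parity ∘ suc) (+-suc x (k * 2)) ⟩
  parity (x + k * 2)              ≡⟨ parity-+-even x k ⟩
  parity x                        ∎
  where open ≡-Reasoning

parity-digits : ∀ r q → parity (r + q * 4) ≡ parity r
parity-digits r q = trans (cong (λ m → parity (r + m)) (sym (*-assoc q 2 2))) (parity-+-even r (q * 2))

odd-gap : ∀ {i n} → i < n → parity i ≢ parity n → ∃ λ k → n ≡ i + suc (k * 2)
odd-gap {i} i<n parity≢ with m≤n⇒∃[o]m+o≡n i<n
... | o , refl with even-or-odd o
...   | k , inj₁ refl = k , sym (+-suc i (k * 2))
...   | k , inj₂ refl = ⊥-elim (parity≢ (sym (trans (cong parity (sym (+-suc i (suc (k * 2))))) (parity-+-even i (suc k)))))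

v<v*4 : ∀ {u v} → u < v → v < v * 4
v<v*4 {v = suc v} _ = 1+q<4+q*4 v

⊓-suc-bound : ∀ {a b c d} → a ≤ suc d → b ≤ suc c → a ⊓ b ≤ suc (c ⊓ d)
⊓-suc-bound a≤ b≤ = ⊓-glb (≤-trans (m⊓n≤n _ _) b≤) (≤-trans (m⊓n≤m _ _) a≤)

-- The Thue–Morse word

complement : Letter → Letter
complement a = b
complement b = a

complement-≢ : ∀ c → complement c ≢ c
complement-≢ a ()
complement-≢ b ()

σ-at : ℕ → Letter → Letter
σ-at 0 c = c
σ-at 1 c = complement c
σ-at 2 c = complement c
σ-at _ c = c

σ-at-mirror : ∀ r r' c → r + r' ≡ 3 → σ-at r c ≡ σ-at r' c
σ-at-mirror 0 _ c refl = refl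
σ-at-mirror 1 _ c refl = refl
σ-at-mirror 2 _ c refl = refl
σ-at-mirror 3 _ c refl = refl
σ-at-mirror (suc (suc (suc (suc r)))) r' c ()

σ*-++ : ∀ xs ys → σ* (xs ++ ys) ≡ σ* xs ++ σ* ys
σ*-++ [] ys = refl
σ*-++ (x ∷ xs) ys = trans (cong (σ x ++_) (σ*-++ xs ys)) (sym (++-assoc (σ x) (σ* xs) (σ* ys)))

length-σ* : ∀ w → length (σ* w) ≡ length w * 4
length-σ* [] = refl
length-σ* (a ∷ w) = cong (4 +_) (length-σ* w)
length-σ* (b ∷ w) = cong (4 +_) (length-σ* w)

lookupD-++ˡ : ∀ d xs ys {i} → i < length xs → lookupD d (xs ++ ys) i ≡ lookupD d xs i
lookupD-++ˡ d (x ∷ xs) ys {zero} _ = refl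
lookupD-++ˡ d (x ∷ xs) ys {suc i} (s≤s i<n) = lookupD-++ˡ d xs ys i<n

lookupD-σ* : ∀ d w q r → r < 4 → q < length w → lookupD d (σ* w) (q * 4 + r) ≡ σ-at r (lookupD d w q)
lookupD-σ* d (a ∷ w) zero 0 _ _ = refl
lookupD-σ* d (a ∷ w) zero 1 _ _ = refl
lookupD-σ* d (a ∷ w) zero 2 _ _ = refl
lookupD-σ* d (a ∷ w) zero 3 _ _ = refl
lookupD-σ* d (b ∷ w) zero 0 _ _ = refl
lookupD-σ* d (b ∷ w) zero 1 _ _ = refl
lookupD-σ* d (b ∷ w) zero 2 _ _ = refl
lookupD-σ* d (b ∷ w) zero 3 _ _ = refl
lookupD-σ* d (_ ∷ w) zero (suc (suc (suc (suc r)))) (s≤s (s≤s (s≤s (s≤s ())))) _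
lookupD-σ* d (a ∷ w) (suc q) r r<4 (s≤s q<n) = lookupD-σ* d w q r r<4 q<n
lookupD-σ* d (b ∷ w) (suc q) r r<4 (s≤s q<n) = lookupD-σ* d w q r r<4 q<n

length-σ^-suc : ∀ m → length (σ^ (suc m)) ≡ length (σ^ m) * 4
length-σ^-suc m = length-σ* (σ^ m)

n<length-σ^ : ∀ n → n < length (σ^ n)
n<length-σ^ zero = s≤s z≤n
n<length-σ^ (suc n) = begin-strict
  suc n                <⟨ m<m*n (suc n) 4 (s≤s (s≤s z≤n)) ⟩
  suc n * 4            ≤⟨ *-monoˡ-≤ 4 (n<length-σ^ n) ⟩
  length (σ^ n) * 4    ≡⟨ length-σ^-suc n ⟨
  length (σ^ (suc n))  ∎
  where open ≤-Reasoning

length-σ^-mono : ∀ n → length (σ^ n) ≤ length (σ^ (suc n))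
length-σ^-mono n = subst (length (σ^ n) ≤_) (sym (length-σ^-suc n)) (m≤m*n (length (σ^ n)) 4)

σ^-prefix-suc : ∀ m → ∃ λ r → σ^ (suc m) ≡ σ^ m ++ r
σ^-prefix-suc zero = b ∷ b ∷ a ∷ [] , refl
σ^-prefix-suc (suc m) with σ^-prefix-suc m
... | r , e = σ* r , trans (cong σ* e) (σ*-++ (σ^ m) r)

σ^-prefix : ∀ k m → ∃ λ r → σ^ (k + m) ≡ σ^ m ++ r
σ^-prefix zero m = [] , sym (++-identityʳ (σ^ m))
σ^-prefix (suc k) m with σ^-prefix k m | σ^-prefix-suc (k + m)
... | r₁ , e₁ | r₂ , e₂ = r₁ ++ r₂ , trans e₂ (trans (cong (_++ r₂) e₁) (++-assoc (σ^ m) r₁ r₂))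

lookupD-σ^ : ∀ m n → n < length (σ^ m) → lookupD a (σ^ m) n ≡ t n
lookupD-σ^ m n n<m with σ^-prefix (suc n) m | σ^-prefix m (suc n)
... | r₁ , e₁ | r₂ , e₂ = begin
  lookupD a (σ^ m) n                 ≡⟨ lookupD-++ˡ a (σ^ m) r₁ n<m ⟨
  lookupD a (σ^ m ++ r₁) n           ≡⟨ cong (λ w → lookupD a w n) e₁ ⟨
  lookupD a (σ^ (suc n + m)) n       ≡⟨ cong (λ k → lookupD a (σ^ k) n) (+-comm (suc n) m) ⟩
  lookupD a (σ^ (m + suc n)) n       ≡⟨ cong (λ w → lookupD a w n) e₂ ⟩
  lookupD a (σ^ (suc n) ++ r₂) n     ≡⟨ lookupD-++ˡ a (σ^ (suc n)) r₂ (<-≤-trans (n<length-σ^ n) (length-σ^-mono n)) ⟩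
  t n                                ∎
  where open ≡-Reasoning

q*4+r<length-σ^ : ∀ q r → r < 4 → q * 4 + r < length (σ^ (suc (suc q)))
q*4+r<length-σ^ q r r<4 = begin-strict
  q * 4 + r                  <⟨ +-monoʳ-< (q * 4) r<4 ⟩
  q * 4 + 4                  ≡⟨ +-comm (q * 4) 4 ⟩
  suc q * 4                  ≤⟨ *-monoˡ-≤ 4 (<⇒≤ (n<length-σ^ (suc q))) ⟩
  length (σ^ (suc q)) * 4    ≡⟨ length-σ^-suc (suc q) ⟨
  length (σ^ (suc (suc q)))  ∎
  where open ≤-Reasoning

t-σ : ∀ q r → r < 4 → t (r + q * 4) ≡ σ-at r (t q)
t-σ q r r<4 = begin
  t (r + q * 4)                             ≡⟨ cong t (+-comm r (q * 4)) ⟩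
  t (q * 4 + r)                             ≡⟨ lookupD-σ^ (suc (suc q)) (q * 4 + r) (q*4+r<length-σ^ q r r<4) ⟨
  lookupD a (σ^ (suc (suc q))) (q * 4 + r)  ≡⟨ lookupD-σ* a (σ^ (suc q)) q r r<4 (<-≤-trans (n<length-σ^ q) (length-σ^-mono q)) ⟩
  σ-at r (t q)                              ∎
  where open ≡-Reasoning

t[4q] : ∀ q → t (q * 4) ≡ t q
t[4q] q = t-σ q 0 0<4

t[1+4q] : ∀ q → t (1 + q * 4) ≡ complement (t q)
t[1+4q] q = t-σ q 1 1<4

t[2+4q] : ∀ q → t (2 + q * 4) ≡ complement (t q)
t[2+4q] q = t-σ q 2 2<4

t[3+4q] : ∀ q → t (3 + q * 4) ≡ t q
t[3+4q] q = t-σ q 3 3<4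

complement-injective : ∀ {x y} → complement x ≡ complement y → x ≡ y
complement-injective {a} {a} _ = refl
complement-injective {b} {b} _ = refl

t[2m]≢t[1+2m] : ∀ m → t (m * 2) ≢ t (1 + m * 2)
t[2m]≢t[1+2m] m e with even-or-odd m
... | k , inj₁ refl = complement-≢ (t k) (begin
  complement (t k)   ≡⟨ t[1+4q] k ⟨
  t (1 + k * 4)      ≡⟨ cong (λ x → t (1 + x)) (*-assoc k 2 2) ⟨
  t (1 + k * 2 * 2)  ≡⟨ e ⟨
  t (k * 2 * 2)      ≡⟨ cong t (*-assoc k 2 2) ⟩
  t (k * 4)          ≡⟨ t[4q] k ⟩
  t k                ∎)
  where open ≡-Reasoning
... | k , inj₂ refl = complement-≢ (t k) (begin
  complement (t k)   ≡⟨ t[2+4q] k ⟨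
  t (2 + k * 4)      ≡⟨ cong (λ x → t (2 + x)) (*-assoc k 2 2) ⟨
  t (2 + k * 2 * 2)  ≡⟨ e ⟩
  t (3 + k * 2 * 2)  ≡⟨ cong (λ x → t (3 + x)) (*-assoc k 2 2) ⟩
  t (3 + k * 4)      ≡⟨ t[3+4q] k ⟩
  t k                ∎)
  where open ≡-Reasoning

-- The recursion for PPL

quotRem4 : ℕ → ℕ × ℕ
quotRem4 0 = 0 , 0
quotRem4 1 = 0 , 1
quotRem4 2 = 0 , 2
quotRem4 3 = 0 , 3
quotRem4 (suc (suc (suc (suc n)))) = map₁ suc (quotRem4 n)

quotRem4[4q] : ∀ q → quotRem4 (q * 4) ≡ (q , 0)
quotRem4[4q] zero = refl
quotRem4[4q] (suc q) = cong (map₁ suc) (quotRem4[4q] q)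

quotRem4[1+4q] : ∀ q → quotRem4 (1 + q * 4) ≡ (q , 1)
quotRem4[1+4q] zero = refl
quotRem4[1+4q] (suc q) = cong (map₁ suc) (quotRem4[1+4q] q)

quotRem4[2+4q] : ∀ q → quotRem4 (2 + q * 4) ≡ (q , 2)
quotRem4[2+4q] zero = refl
quotRem4[2+4q] (suc q) = cong (map₁ suc) (quotRem4[2+4q] q)

quotRem4[3+4q] : ∀ q → quotRem4 (3 + q * 4) ≡ (q , 3)
quotRem4[3+4q] zero = refl
quotRem4[3+4q] (suc q) = cong (map₁ suc) (quotRem4[3+4q] q)

pplStep : (ℕ → ℕ) → ℕ × ℕ → ℕ
pplStep g (q , 0) = g q
pplStep g (q , 1) = suc (g q)
pplStep g (q , 2) = 2 + g q ⊓ g (suc q)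
pplStep g (q , _) = suc (g (suc q))

pplFuel : ℕ → ℕ → ℕ
pplFuel zero n = 0
pplFuel (suc k) n = pplStep (pplFuel k) (quotRem4 n)

ppl : ℕ → ℕ
ppl n = pplFuel (suc n) n

pplFuel-0 : ∀ k → pplFuel k 0 ≡ 0
pplFuel-0 zero = refl
pplFuel-0 (suc k) = pplFuel-0 k

pplFuel-stable : ∀ k k' n → n < k → n < k' → pplFuel k n ≡ pplFuel k' n
pplFuel-stable (suc k) (suc k') n (s≤s n≤k) (s≤s n≤k') with lastDigit n
... | ends0 zero = trans (pplFuel-0 k) (sym (pplFuel-0 k'))
... | ends0 (suc q) rewrite quotRem4[4q] (suc q) =
  pplFuel-stable k k' (suc q) (<-≤-trans (1+q<4+q*4 q) n≤k) (<-≤-trans (1+q<4+q*4 q) n≤k')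
... | ends1 q rewrite quotRem4[1+4q] q =
  cong suc (pplFuel-stable k k' q (<-≤-trans (q<1+q*4 q) n≤k) (<-≤-trans (q<1+q*4 q) n≤k'))
... | ends2 q rewrite quotRem4[2+4q] q = cong₂ (λ x y → 2 + x ⊓ y)
  (pplFuel-stable k k' q (<-≤-trans (q<2+q*4 q) n≤k) (<-≤-trans (q<2+q*4 q) n≤k'))
  (pplFuel-stable k k' (suc q) (<-≤-trans (1+q<2+q*4 q) n≤k) (<-≤-trans (1+q<2+q*4 q) n≤k'))
... | ends3 q rewrite quotRem4[3+4q] q =
  cong suc (pplFuel-stable k k' (suc q) (<-≤-trans (1+q<3+q*4 q) n≤k) (<-≤-trans (1+q<3+q*4 q) n≤k'))

pplFuel≡ppl : ∀ k n → n < k → pplFuel k n ≡ ppl n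
pplFuel≡ppl k n n<k = pplFuel-stable k (suc n) n n<k ≤-refl

ppl[4q] : ∀ q → ppl (q * 4) ≡ ppl q
ppl[4q] zero = refl
ppl[4q] (suc q) rewrite quotRem4[4q] (suc q) = pplFuel≡ppl (suc q * 4) (suc q) (1+q<4+q*4 q)

ppl[1+4q] : ∀ q → ppl (1 + q * 4) ≡ suc (ppl q)
ppl[1+4q] q rewrite quotRem4[1+4q] q = cong suc (pplFuel≡ppl (1 + q * 4) q (q<1+q*4 q))

ppl[2+4q] : ∀ q → ppl (2 + q * 4) ≡ 2 + ppl q ⊓ ppl (suc q)
ppl[2+4q] q rewrite quotRem4[2+4q] q = cong₂ (λ x y → 2 + x ⊓ y)
  (pplFuel≡ppl (2 + q * 4) q (q<2+q*4 q)) (pplFuel≡ppl (2 + q * 4) (suc q) (1+q<2+q*4 q))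

ppl[3+4q] : ∀ q → ppl (3 + q * 4) ≡ suc (ppl (suc q))
ppl[3+4q] q rewrite quotRem4[3+4q] q = cong suc (pplFuel≡ppl (3 + q * 4) (suc q) (1+q<3+q*4 q))

ppl-suc≤ : ∀ n → ppl (suc n) ≤ suc (ppl n)
ppl-suc≤ = <-rec _ step
  where
  step : ∀ n → (∀ {m} → m < n → ppl (suc m) ≤ suc (ppl m)) → ppl (suc n) ≤ suc (ppl n)
  step n rec with lastDigit n
  ... | ends0 q rewrite ppl[1+4q] q | ppl[4q] q = ≤-refl
  ... | ends1 q rewrite ppl[2+4q] q | ppl[1+4q] q = s≤s (s≤s (m⊓n≤m (ppl q) (ppl (suc q))))
  ... | ends2 q rewrite ppl[3+4q] q | ppl[2+4q] q = s≤s (≤-trans (⊓-glb (rec (q<2+q*4 q)) (n≤1+n _)) (n≤1+n _))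
  ... | ends3 q rewrite ppl[3+4q] q | ppl[4q] (suc q) = ≤-trans (n≤1+n _) (n≤1+n _)

-- Where ppl first reaches a value

mutual
  sp : ℕ → ℕ
  sp 0 = 0
  sp (suc i) = suc (spPred i)

  spPred : ℕ → ℕ
  spPred 0 = 0
  spPred (suc i) = suc (spPair i * 4)

  -- spPair j is the least n with j ≤ ppl n and j ≤ ppl (suc n).
  spPair : ℕ → ℕ
  spPair 0 = 0
  spPair 1 = 1
  spPair (suc (suc i)) = 2 + spPred i * 4

mutual
  spPair≤spPred : ∀ i → spPair i ≤ spPred i
  spPair≤spPred 0 = z≤n
  spPair≤spPred 1 = s≤s z≤n
  spPair≤spPred (suc (suc i)) = digits-carry-≤ (s≤s (s≤s z≤n)) (spPred<spPair i)

  spPred<spPair : ∀ i → spPred i < spPair (suc i)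
  spPred<spPair 0 = s≤s z≤n
  spPred<spPair (suc i) = digits-mono-≤ ≤-refl (spPair≤spPred i)

spPred-mono : ∀ i → spPred i ≤ spPred (suc i)
spPred-mono i = ≤-trans (n≤1+n _) (≤-trans (spPred<spPair i) (spPair≤spPred (suc i)))

SpLeast : ℕ → ℕ → Set
SpLeast n j = (j ≤ ppl n → sp j ≤ n) × (j ≤ ppl n → j ≤ ppl (suc n) → spPair j ≤ n)

spLeast : ∀ n j → SpLeast n j
spLeast = <-rec (λ n → ∀ j → SpLeast n j) step
  where
  step : ∀ n → (∀ {m} → m < n → ∀ j → SpLeast m j) → ∀ j → SpLeast n j
  step n rec 0 = (λ _ → z≤n) , (λ _ _ → z≤n)
  step zero rec 1 = (λ ()) , (λ ())
  step (suc n) rec 1 = (λ _ → s≤s z≤n) , (λ _ _ → s≤s z≤n)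
  step n rec (suc (suc i)) with lastDigit n
  ... | ends0 zero = (λ ()) , (λ ())
  ... | ends0 (suc q) = sp≤n , spPair≤n
    where
    sp≤q : 2 + i ≤ ppl (suc q * 4) → sp (2 + i) ≤ suc q
    sp≤q h = proj₁ (rec (1+q<4+q*4 q) (2 + i)) (subst (2 + i ≤_) (ppl[4q] (suc q)) h)
    sp≤n : 2 + i ≤ ppl (suc q * 4) → sp (2 + i) ≤ suc q * 4
    sp≤n h = ≤-trans (sp≤q h) (m≤m*n (suc q) 4)
    spPair≤n : 2 + i ≤ ppl (suc q * 4) → _ → spPair (2 + i) ≤ suc q * 4
    spPair≤n h _ = digits-carry-≤ {d = 0} (s≤s (s≤s z≤n)) (≤-trans (s≤s (spPred-mono i)) (sp≤q h))
  ... | ends1 q = sp≤n , spPair≤n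
    where
    sp≤q : 2 + i ≤ ppl (1 + q * 4) → sp (suc i) ≤ q
    sp≤q h = proj₁ (rec (q<1+q*4 q) (suc i)) (≤-pred (subst (2 + i ≤_) (ppl[1+4q] q) h))
    sp≤n : 2 + i ≤ ppl (1 + q * 4) → sp (2 + i) ≤ 1 + q * 4
    sp≤n h = digits-carry-≤ (s≤s (s≤s z≤n)) (≤-trans (s≤s (spPair≤spPred i)) (sp≤q h))
    spPair≤n : 2 + i ≤ ppl (1 + q * 4) → _ → spPair (2 + i) ≤ 1 + q * 4
    spPair≤n h _ = digits-carry-≤ (s≤s (s≤s z≤n)) (sp≤q h)
  ... | ends2 q = sp≤n , spPair≤n
    where
    sp≤n : 2 + i ≤ ppl (2 + q * 4) → sp (2 + i) ≤ 2 + q * 4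
    sp≤n h = digits-mono-≤ ≤-refl (proj₂ (rec (q<2+q*4 q) i) (≤-trans i≤ (m⊓n≤m _ _)) (≤-trans i≤ (m⊓n≤n _ _)))
      where
      i≤ : i ≤ ppl q ⊓ ppl (suc q)
      i≤ = ≤-pred (≤-pred (subst (2 + i ≤_) (ppl[2+4q] q) h))
    spPair≤n : _ → 2 + i ≤ ppl (3 + q * 4) → spPair (2 + i) ≤ 2 + q * 4
    spPair≤n _ h = digits-mono-≤ ≤-refl (≤-pred (proj₁ (rec (1+q<2+q*4 q) (suc i)) (≤-pred (subst (2 + i ≤_) (ppl[3+4q] q) h))))
  ... | ends3 q = sp≤n , spPair≤n
    where
    sp≤n : 2 + i ≤ ppl (3 + q * 4) → sp (2 + i) ≤ 3 + q * 4
    sp≤n h = digits-mono-≤ (s≤s (s≤s z≤n)) (≤-trans (spPair≤spPred i)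
      (≤-pred (proj₁ (rec (1+q<3+q*4 q) (suc i)) (≤-pred (subst (2 + i ≤_) (ppl[3+4q] q) h)))))
    spPair≤n : _ → 2 + i ≤ ppl (suc q * 4) → spPair (2 + i) ≤ 3 + q * 4
    spPair≤n _ h = digits-mono-≤ (s≤s (s≤s z≤n)) (≤-trans (spPred-mono i)
      (≤-pred (proj₁ (rec (1+q<3+q*4 q) (2 + i)) (subst (2 + i ≤_) (ppl[4q] (suc q)) h))))

sp-least : ∀ n j → j ≤ ppl n → sp j ≤ n
sp-least n j = proj₁ (spLeast n j)

Reached : ℕ → Set
Reached j = j ≤ ppl (sp j) × j ≤ ppl (spPair j) × j ≤ ppl (suc (spPair j))

reached : ∀ j → Reached j × Reached (suc j)
reached zero = (z≤n , z≤n , z≤n) , (s≤s z≤n , s≤s z≤n , s≤s z≤n)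
reached (suc j) with reached j
... | (_ , atPair , atPair+1) , next@(atSp , _) = next , atSp′ , atPair′ , atPair+1′
  where
  j≤atSpPred : j ≤ ppl (spPred j)
  j≤atSpPred = ≤-pred (≤-trans atSp (ppl-suc≤ (spPred j)))
  atSp′ : 2 + j ≤ ppl (sp (2 + j))
  atSp′ = subst (2 + j ≤_) (sym (ppl[2+4q] (spPair j))) (s≤s (s≤s (⊓-glb atPair atPair+1)))
  atPair′ : 2 + j ≤ ppl (spPair (2 + j))
  atPair′ = subst (2 + j ≤_) (sym (ppl[2+4q] (spPred j))) (s≤s (s≤s (⊓-glb j≤atSpPred (≤-trans (n≤1+n j) atSp))))
  atPair+1′ : 2 + j ≤ ppl (suc (spPair (2 + j)))
  atPair+1′ = subst (2 + j ≤_) (sym (ppl[3+4q] (spPred j))) (s≤s atSp)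

ppl-sp : ∀ j → ppl (sp j) ≡ j
ppl-sp zero = refl
ppl-sp (suc i) = ≤-antisym (≤-trans (ppl-suc≤ (spPred i)) (s≤s atSpPred≤i)) (proj₁ (proj₁ (reached (suc i))))
  where
  atSpPred≤i : ppl (spPred i) ≤ i
  atSpPred≤i = ≮⇒≥ (λ i<ppl → <-irrefl refl (sp-least (spPred i) (suc i) i<ppl))

-- Palindromic factors of t

-- The factor t[i..n) is a palindrome, stated letterwise: x and y are mirror positions iff x + y + 1 = i + n.
Palindromic : ℕ → ℕ → Set
Palindromic i n = ∀ x y → i ≤ x → x < n → x + y + 1 ≡ i + n → t x ≡ t y

mirror< : ∀ {x y i n} → x + y + 1 ≡ i + n → i ≤ y → x < n
mirror< {x} {y} {i} {n} e i≤y = +-cancelʳ-≤ y (suc x) n (begin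
  suc x + y  ≡⟨ +-comm (x + y) 1 ⟨
  x + y + 1  ≡⟨ e ⟩
  i + n      ≤⟨ +-monoˡ-≤ n i≤y ⟩
  y + n      ≡⟨ +-comm y n ⟩
  n + y      ∎)
  where open ≤-Reasoning

mirror≥ : ∀ {x y i n} → x + y + 1 ≡ i + n → x < n → i ≤ y
mirror≥ {x} {y} {i} {n} e x<n = +-cancelʳ-≤ n i y (begin
  i + n      ≡⟨ e ⟨
  x + y + 1  ≡⟨ +-comm (x + y) 1 ⟩
  suc x + y  ≤⟨ +-monoˡ-≤ y x<n ⟩
  n + y      ≡⟨ +-comm n y ⟩
  y + n      ∎)
  where open ≤-Reasoning

palindromic-mirror : ∀ {i n} → Palindromic i n → ∀ {x y} → i ≤ x → i ≤ y → x + y + 1 ≡ i + n → t x ≡ t y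
palindromic-mirror P {x} {y} i≤x i≤y e = P x y i≤x (mirror< e i≤y) e

Palindromic-inner : ∀ {i n} → Palindromic i (suc n) → Palindromic (suc i) n
Palindromic-inner {i} {n} P x y i<x x<n e = P x y (<⇒≤ i<x) (m<n⇒m<1+n x<n) (trans e (sym (+-suc i n)))

Palindromic-singleton : ∀ m → Palindromic m (suc m)
Palindromic-singleton m x y m≤x x<1+m e with ≤-antisym (≤-pred x<1+m) m≤x
... | refl = cong t (sym y≡m)
  where
  y≡m : y ≡ m
  y≡m = suc-injective (trans (+-comm 1 y) (+-cancelˡ-≡ m (y + 1) (suc m) (trans (sym (+-assoc m y 1)) e)))

-- Mirror positions r + 4q, r' + 4q' of [i, n) have r + r' = 3 and q, q' mirror in [x, y); as σ a and σ b
-- are palindromes, σ-at r and σ-at r' then agree.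
Palindromic-σ : ∀ {x y i n} → Palindromic x y → x * 4 ≤ i → n ≤ y * 4 → i + n ≡ (x + y) * 4 → Palindromic i n
Palindromic-σ {x} {y} {i} {n} P 4x≤i n≤4y e p p' i≤p p<n mirror
  with digits p | digits p'
... | r , q , r<4 , refl | r' , q' , r'<4 , refl = begin
  t (r + q * 4)     ≡⟨ t-σ q r r<4 ⟩
  σ-at r (t q)      ≡⟨ cong (σ-at r) (P q q' x≤q q<y (trans (+-comm (q + q') 1) 1+Q≡S)) ⟩
  σ-at r (t q')     ≡⟨ σ-at-mirror r r' (t q') r+r'≡3 ⟩
  σ-at r' (t q')    ≡⟨ t-σ q' r' r'<4 ⟨
  t (r' + q' * 4)   ∎
  where
  open ≡-Reasoning
  rearranged : (r + r' + 1) + (q + q') * 4 ≡ (x + y) * 4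
  rearranged = trans (regroup r r' q q') (trans mirror e)
    where
    regroup : ∀ r r' q q' → (r + r' + 1) + (q + q') * 4 ≡ (r + q * 4) + (r' + q' * 4) + 1
    regroup = solve-∀
  carry = base4-carry r<4 r'<4 rearranged
  r+r'≡3 = proj₁ carry
  1+Q≡S = proj₂ carry
  x≤q : x ≤ q
  x≤q = quot-mono-≤ {c = 0} r<4 (≤-trans 4x≤i i≤p)
  q<y : q < y
  q<y = quot-mono-< {d = 0} z≤n (<-≤-trans p<n n≤4y)

Palindromic-desubstitute : ∀ {i n u v} → i ≤ 3 + u * 4 → i + n ≡ (u + v) * 4 → Palindromic i n → Palindromic u v
Palindromic-desubstitute {i} {n} {u} {v} i≤3+4u e P q q' u≤q q<v mirror = by-order (<-cmp q q')
  where
  -- the mirror positions q < q' of [u, v) lift to the mirror positions 3 + 4q, 4q' of [i, n)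
  lift : ∀ {q q'} → u ≤ q → q < q' → q + q' + 1 ≡ u + v → t q ≡ t q'
  lift {q} {q'} u≤q q<q' s = begin
    t q             ≡⟨ t[3+4q] q ⟨
    t (3 + q * 4)   ≡⟨ palindromic-mirror P i≤3+4q i≤4q' lifted ⟩
    t (q' * 4)      ≡⟨ t[4q] q' ⟩
    t q'            ∎
    where
    open ≡-Reasoning
    i≤3+4q : i ≤ 3 + q * 4
    i≤3+4q = ≤-trans i≤3+4u (digits-mono-≤ ≤-refl u≤q)
    i≤4q' : i ≤ q' * 4
    i≤4q' = ≤-trans i≤3+4u (digits-carry-≤ {d = 0} (n≤1+n 3) (≤-<-trans u≤q q<q'))
    regroup : ∀ q q' → (3 + q * 4) + q' * 4 + 1 ≡ (q + q' + 1) * 4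
    regroup = solve-∀
    lifted : (3 + q * 4) + q' * 4 + 1 ≡ i + n
    lifted = trans (regroup q q') (trans (cong (_* 4) s) (sym e))
  by-order : Tri (q < q') (q ≡ q') (q' < q) → t q ≡ t q'
  by-order (tri< q<q' _ _) = lift u≤q q<q' mirror
  by-order (tri≈ _ refl _) = refl
  by-order (tri> _ _ q'<q) = sym (lift (mirror≥ mirror q<v) q'<q (trans (cong (_+ 1) (+-comm q' q)) mirror))

¬Palindromic-centred-at-odd : ∀ {i n m} → i < n → i + n ≡ 2 + m * 4 → ¬ Palindromic i n
¬Palindromic-centred-at-odd {i} {n} {m} i<n e P =
  t[2m]≢t[1+2m] m (palindromic-mirror P i≤2m (m≤n⇒m≤1+n i≤2m) (trans (regroup m) (sym e)))
  where
  regroup : ∀ m → m * 2 + (1 + m * 2) + 1 ≡ 2 + m * 4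
  regroup = solve-∀
  i≤2m : i ≤ m * 2
  i≤2m = ≮⇒≥ (λ 2m<i → <-irrefl refl (begin-strict
    2 + m * 4                    ≡⟨ regroup m ⟨
    m * 2 + (1 + m * 2) + 1      ≡⟨ +-comm (m * 2 + (1 + m * 2)) 1 ⟩
    suc (m * 2) + suc (m * 2)    ≤⟨ +-mono-≤ 2m<i 2m<i ⟩
    i + i                        <⟨ +-monoʳ-< i i<n ⟩
    i + n                        ≡⟨ e ⟩
    2 + m * 4                    ∎))
    where open ≤-Reasoning

¬Palindromic-length-5 : ∀ i → ¬ Palindromic i (i + 5)
¬Palindromic-length-5 i P with lastDigit i
... | ends0 q = complement-≢ (t q) (begin
  complement (t q)  ≡⟨ t[1+4q] q ⟨
  t (1 + q * 4)     ≡⟨ palindromic-mirror P (n≤1+n _) (+-monoˡ-≤ (q * 4) (z≤n {3})) (regroup q) ⟩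
  t (3 + q * 4)     ≡⟨ t[3+4q] q ⟩
  t q               ∎)
  where
  open ≡-Reasoning
  regroup : ∀ q → (1 + q * 4) + (3 + q * 4) + 1 ≡ q * 4 + (q * 4 + 5)
  regroup = solve-∀
... | ends1 q = complement-≢ (t q) (trans e₁ (sym (complement-injective e₂)))
  where
  regroup₁ : ∀ q → (2 + q * 4) + suc q * 4 + 1 ≡ (1 + q * 4) + ((1 + q * 4) + 5)
  regroup₁ = solve-∀
  regroup₂ : ∀ q → (1 + q * 4) + (1 + suc q * 4) + 1 ≡ (1 + q * 4) + ((1 + q * 4) + 5)
  regroup₂ = solve-∀
  e₁ : complement (t q) ≡ t (suc q)
  e₁ = trans (sym (t[2+4q] q)) (trans (palindromic-mirror P (n≤1+n _) (+-monoˡ-≤ (q * 4) (s≤s z≤n)) (regroup₁ q)) (t[4q] (suc q)))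
  e₂ : complement (t q) ≡ complement (t (suc q))
  e₂ = trans (sym (t[1+4q] q)) (trans (palindromic-mirror P ≤-refl (+-monoˡ-≤ (q * 4) (s≤s z≤n)) (regroup₂ q)) (t[1+4q] (suc q)))
... | ends2 q = complement-≢ (t (suc q)) (trans (sym e₁) (complement-injective e₂))
  where
  regroup₁ : ∀ q → (3 + q * 4) + (1 + suc q * 4) + 1 ≡ (2 + q * 4) + ((2 + q * 4) + 5)
  regroup₁ = solve-∀
  regroup₂ : ∀ q → (2 + q * 4) + (2 + suc q * 4) + 1 ≡ (2 + q * 4) + ((2 + q * 4) + 5)
  regroup₂ = solve-∀
  e₁ : t q ≡ complement (t (suc q))
  e₁ = trans (sym (t[3+4q] q)) (trans (palindromic-mirror P (n≤1+n _) (+-monoˡ-≤ (q * 4) (s≤s (s≤s z≤n))) (regroup₁ q)) (t[1+4q] (suc q)))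
  e₂ : complement (t q) ≡ complement (t (suc q))
  e₂ = trans (sym (t[2+4q] q)) (trans (palindromic-mirror P ≤-refl (+-monoˡ-≤ (q * 4) (s≤s (s≤s z≤n))) (regroup₂ q)) (t[2+4q] (suc q)))
... | ends3 q = complement-≢ (t (suc q)) (sym e)
  where
  regroup : ∀ q → suc q * 4 + (2 + suc q * 4) + 1 ≡ (3 + q * 4) + ((3 + q * 4) + 5)
  regroup = solve-∀
  e : t (suc q) ≡ complement (t (suc q))
  e = trans (sym (t[4q] (suc q))) (trans (palindromic-mirror P (n≤1+n _) (+-monoˡ-≤ (q * 4) (s≤s (s≤s (s≤s z≤n)))) (regroup q)) (t[2+4q] (suc q)))

¬Palindromic-odd-length≥5 : ∀ k i → ¬ Palindromic i (i + (5 + k * 2))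
¬Palindromic-odd-length≥5 zero i = ¬Palindromic-length-5 i
¬Palindromic-odd-length≥5 (suc k) i P = ¬Palindromic-odd-length≥5 k (suc i)
  (subst (Palindromic (suc i)) (+-suc i (5 + k * 2)) (Palindromic-inner (subst (Palindromic i) (+-suc i (6 + k * 2)) P)))

-- ppl n palindromes suffice

data Factorisation : ℕ → ℕ → Set where
  nil  : Factorisation 0 0
  snoc : ∀ {m n j} → m < n → Palindromic m n → Factorisation m j → Factorisation n (suc j)

Factorisation-σ : ∀ {m j} → Factorisation m j → Factorisation (m * 4) j
Factorisation-σ nil = nil
Factorisation-σ (snoc {m} {n} m<n P F) =
  snoc (*-monoˡ-< 4 m<n) (Palindromic-σ P ≤-refl ≤-refl (sym (*-distribʳ-+ 4 m n))) (Factorisation-σ F)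

Factorisation-σ+1 : ∀ {m j} → Factorisation m j → Factorisation (1 + m * 4) (1 + j)
Factorisation-σ+1 {m} F = snoc ≤-refl (Palindromic-singleton (m * 4)) (Factorisation-σ F)

Factorisation-σ+2 : ∀ {m j} → Factorisation m j → Factorisation (2 + m * 4) (2 + j)
Factorisation-σ+2 {m} F = snoc ≤-refl (Palindromic-singleton (1 + m * 4)) (Factorisation-σ+1 F)

FactorisableWithin : ℕ → ℕ → Set
FactorisableWithin n k = ∃ λ j → j ≤ k × Factorisation n j

FactorisableWithin-σ : ∀ {m k} → FactorisableWithin m k → FactorisableWithin (m * 4) k
FactorisableWithin-σ (j , j≤k , F) = j , j≤k , Factorisation-σ F

FactorisableWithin-σ+1 : ∀ {m k} → FactorisableWithin m k → FactorisableWithin (1 + m * 4) (1 + k)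
FactorisableWithin-σ+1 (j , j≤k , F) = 1 + j , s≤s j≤k , Factorisation-σ+1 F

FactorisableWithin-σ+2 : ∀ {m k} → FactorisableWithin m k → FactorisableWithin (2 + m * 4) (2 + k)
FactorisableWithin-σ+2 (j , j≤k , F) = 2 + j , s≤s (s≤s j≤k) , Factorisation-σ+2 F

-- The σ-image t[4m..4q+4) of the last factor t[m..q+1), trimmed by one or two letters at each end, stays a palindrome.
FactorisableWithin-3+4q : ∀ {q k} → FactorisableWithin (suc q) k → FactorisableWithin (3 + q * 4) (1 + k)
FactorisableWithin-3+4q (zero , _ , ())
FactorisableWithin-3+4q {q} (suc j , j<k , snoc {m} m<1+q P F) = 2 + j , s≤s j<k ,
  snoc (s≤s (s≤s (m≤n⇒m≤1+n (*-monoˡ-≤ 4 (≤-pred m<1+q)))))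
       (Palindromic-σ P (n≤1+n _) (n≤1+n _) (regroup m q))
       (Factorisation-σ+1 F)
  where
  regroup : ∀ m q → (1 + m * 4) + (3 + q * 4) ≡ (m + suc q) * 4
  regroup = solve-∀

FactorisableWithin-2+4q : ∀ {q k} → FactorisableWithin (suc q) k → FactorisableWithin (2 + q * 4) (2 + k)
FactorisableWithin-2+4q (zero , _ , ())
FactorisableWithin-2+4q {q} (suc j , j<k , snoc {m} m<1+q P F) with m≤n⇒m<n∨m≡n (≤-pred m<1+q)
... | inj₂ refl = 2 + j , s≤s (s≤s (<⇒≤ j<k)) , Factorisation-σ+2 F
... | inj₁ m<q = 3 + j , s≤s (s≤s j<k) ,
  snoc (s≤s (s≤s (*-monoˡ-< 4 m<q)))
       (Palindromic-σ P (≤-trans (n≤1+n _) (n≤1+n _)) (≤-trans (n≤1+n _) (n≤1+n _)) (regroup m q))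
       (Factorisation-σ+2 F)
  where
  regroup : ∀ m q → (2 + m * 4) + (2 + q * 4) ≡ (m + suc q) * 4
  regroup = solve-∀

FactorisableWithin-ppl : ∀ {n k} → ppl n ≡ k → FactorisableWithin n k → FactorisableWithin n (ppl n)
FactorisableWithin-ppl {n} e = subst (FactorisableWithin n) (sym e)

factorisation : ∀ n → FactorisableWithin n (ppl n)
factorisation = <-rec _ step
  where
  step : ∀ n → (∀ {m} → m < n → FactorisableWithin m (ppl m)) → FactorisableWithin n (ppl n)
  step n rec with lastDigit n
  ... | ends0 zero = 0 , z≤n , nil
  ... | ends0 (suc q) = FactorisableWithin-ppl (ppl[4q] (suc q)) (FactorisableWithin-σ (rec (1+q<4+q*4 q)))
  ... | ends1 q = FactorisableWithin-ppl (ppl[1+4q] q) (FactorisableWithin-σ+1 (rec (q<1+q*4 q)))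
  ... | ends3 q = FactorisableWithin-ppl (ppl[3+4q] q) (FactorisableWithin-3+4q (rec (1+q<3+q*4 q)))
  ... | ends2 q with ⊓-sel (ppl q) (ppl (suc q))
  ...   | inj₁ min≡ = FactorisableWithin-ppl (trans (ppl[2+4q] q) (cong (2 +_) min≡))
                        (FactorisableWithin-σ+2 (rec (q<2+q*4 q)))
  ...   | inj₂ min≡ = FactorisableWithin-ppl (trans (ppl[2+4q] q) (cong (2 +_) min≡))
                        (FactorisableWithin-2+4q (rec (1+q<2+q*4 q)))

-- Appending a palindrome raises ppl by at most one

ppl-palindrome-step-length-3 : ∀ i → Palindromic i (i + 3) → ppl (i + 3) ≤ suc (ppl i)
ppl-palindrome-step-length-3 i P with lastDigit i
... | ends0 q = ⊥-elim (complement-≢ (t q) (sym (begin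
  t q                ≡⟨ t[4q] q ⟨
  t (q * 4)          ≡⟨ palindromic-mirror P ≤-refl (m≤n+m (q * 4) 2) (regroup q) ⟩
  t (2 + q * 4)      ≡⟨ t[2+4q] q ⟩
  complement (t q)   ∎)))
  where
  open ≡-Reasoning
  regroup : ∀ q → q * 4 + (2 + q * 4) + 1 ≡ q * 4 + (q * 4 + 3)
  regroup = solve-∀
... | ends1 q = ⊥-elim (complement-≢ (t q) (begin
  complement (t q)   ≡⟨ t[1+4q] q ⟨
  t (1 + q * 4)      ≡⟨ palindromic-mirror P ≤-refl (+-monoˡ-≤ (q * 4) (s≤s z≤n)) (regroup q) ⟩
  t (3 + q * 4)      ≡⟨ t[3+4q] q ⟩
  t q                ∎))
  where
  open ≡-Reasoning
  regroup : ∀ q → (1 + q * 4) + (3 + q * 4) + 1 ≡ (1 + q * 4) + ((1 + q * 4) + 3)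
  regroup = solve-∀
... | ends2 q = begin
  ppl ((2 + q * 4) + 3)            ≡⟨ cong ppl (regroup q) ⟩
  ppl (1 + suc q * 4)              ≡⟨ ppl[1+4q] (suc q) ⟩
  suc (ppl (suc q))                ≤⟨ s≤s (⊓-glb (ppl-suc≤ q) (n≤1+n _)) ⟩
  2 + ppl q ⊓ ppl (suc q)          ≤⟨ n≤1+n _ ⟩
  3 + ppl q ⊓ ppl (suc q)          ≡⟨ cong suc (ppl[2+4q] q) ⟨
  suc (ppl (2 + q * 4))            ∎
  where
  open ≤-Reasoning
  regroup : ∀ q → (2 + q * 4) + 3 ≡ 1 + suc q * 4
  regroup = solve-∀
... | ends3 q = begin
  ppl ((3 + q * 4) + 3)                  ≡⟨ cong ppl (regroup q) ⟩
  ppl (2 + suc q * 4)                    ≡⟨ ppl[2+4q] (suc q) ⟩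
  2 + ppl (suc q) ⊓ ppl (suc (suc q))    ≤⟨ s≤s (s≤s (m⊓n≤m _ _)) ⟩
  2 + ppl (suc q)                        ≡⟨ cong suc (ppl[3+4q] q) ⟨
  suc (ppl (3 + q * 4))                  ∎
  where
  open ≤-Reasoning
  regroup : ∀ q → (3 + q * 4) + 3 ≡ 2 + suc q * 4
  regroup = solve-∀

ppl-palindrome-step-odd : ∀ i k → Palindromic i (i + suc (k * 2)) → ppl (i + suc (k * 2)) ≤ suc (ppl i)
ppl-palindrome-step-odd i zero _ = subst (λ n → ppl n ≤ suc (ppl i)) (+-comm 1 i) (ppl-suc≤ i)
ppl-palindrome-step-odd i (suc zero) P = ppl-palindrome-step-length-3 i P
ppl-palindrome-step-odd i (suc (suc k)) P = ⊥-elim (¬Palindromic-odd-length≥5 k i P)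

ppl-palindrome-step-odd-gap : ∀ {r s u v} → parity r ≢ parity s → r + u * 4 < s + v * 4 →
  Palindromic (r + u * 4) (s + v * 4) → ppl (s + v * 4) ≤ suc (ppl (r + u * 4))
ppl-palindrome-step-odd-gap {r} {s} {u} {v} parity≢ i<n P with odd-gap i<n (λ e → parity≢ (trans (sym (parity-digits r u)) (trans e (parity-digits s v))))
... | k , e rewrite e = ppl-palindrome-step-odd (r + u * 4) k P

PalindromeStep : ℕ → Set
PalindromeStep n = ∀ {i} → i < n → Palindromic i n → ppl n ≤ suc (ppl i)

ppl-palindrome-step-inner : ∀ {u v} → PalindromeStep v → u < v → Palindromic u (suc v) → ppl v ≤ suc (ppl (suc u))
ppl-palindrome-step-inner step u<v P with m≤n⇒m<n∨m≡n u<v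
... | inj₁ 1+u<v = step 1+u<v (Palindromic-inner P)
... | inj₂ refl = n≤1+n _

PalindromeStepBelow : ℕ → Set
PalindromeStepBelow n = ∀ {m} → m < n → PalindromeStep m

ppl-palindrome-step[4u,4v] : ∀ {u v} → PalindromeStepBelow (v * 4) → u * 4 < v * 4 →
  Palindromic (u * 4) (v * 4) → ppl (v * 4) ≤ suc (ppl (u * 4))
ppl-palindrome-step[4u,4v] {u} {v} rec i<n P = begin
  ppl (v * 4)          ≡⟨ ppl[4q] v ⟩
  ppl v                ≤⟨ rec (v<v*4 u<v) u<v (Palindromic-desubstitute {u = u} {v} (m≤n+m _ 3) (sym (*-distribʳ-+ 4 u v)) P) ⟩
  suc (ppl u)          ≡⟨ cong suc (ppl[4q] u) ⟨
  suc (ppl (u * 4))    ∎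
  where
  open ≤-Reasoning
  u<v = quot-mono-< {d = 0} ≤-refl i<n

ppl-palindrome-step[1+4u,3+4v] : ∀ {u v} → PalindromeStepBelow (3 + v * 4) → 1 + u * 4 < 3 + v * 4 →
  Palindromic (1 + u * 4) (3 + v * 4) → ppl (3 + v * 4) ≤ suc (ppl (1 + u * 4))
ppl-palindrome-step[1+4u,3+4v] {u} {v} rec i<n P = begin
  ppl (3 + v * 4)            ≡⟨ ppl[3+4q] v ⟩
  suc (ppl (suc v))          ≤⟨ s≤s (rec (1+q<3+q*4 v) (s≤s u≤v) P′) ⟩
  2 + ppl u                  ≡⟨ cong suc (ppl[1+4q] u) ⟨
  suc (ppl (1 + u * 4))      ∎
  where
  open ≤-Reasoning
  u≤v = quot-mono-≤ {c = 1} 3<4 (<⇒≤ i<n)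
  regroup : ∀ u v → (1 + u * 4) + (3 + v * 4) ≡ (u + suc v) * 4
  regroup = solve-∀
  P′ = Palindromic-desubstitute {u = u} {suc v} (+-monoˡ-≤ (u * 4) (s≤s z≤n)) (regroup u v) P

ppl-palindrome-step[2+4u,2+4v] : ∀ {u v} → PalindromeStepBelow (2 + v * 4) → 2 + u * 4 < 2 + v * 4 →
  Palindromic (2 + u * 4) (2 + v * 4) → ppl (2 + v * 4) ≤ suc (ppl (2 + u * 4))
ppl-palindrome-step[2+4u,2+4v] {u} {v} rec i<n P = begin
  ppl (2 + v * 4)                ≡⟨ ppl[2+4q] v ⟩
  2 + ppl v ⊓ ppl (suc v)        ≤⟨ s≤s (s≤s (⊓-suc-bound at-v at-1+v)) ⟩
  3 + ppl u ⊓ ppl (suc u)        ≡⟨ cong suc (ppl[2+4q] u) ⟨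
  suc (ppl (2 + u * 4))          ∎
  where
  open ≤-Reasoning
  u<v = quot-mono-< {d = 2} ≤-refl i<n
  regroup : ∀ u v → (2 + u * 4) + (2 + v * 4) ≡ (u + suc v) * 4
  regroup = solve-∀
  P′ = Palindromic-desubstitute {u = u} {suc v} (+-monoˡ-≤ (u * 4) (n≤1+n 2)) (regroup u v) P
  at-1+v = rec (1+q<2+q*4 v) (m<n⇒m<1+n u<v) P′
  at-v = ppl-palindrome-step-inner (rec (q<2+q*4 v)) u<v P′

ppl-palindrome-step[3+4u,1+4v] : ∀ {u v} → PalindromeStepBelow (1 + v * 4) → 3 + u * 4 < 1 + v * 4 →
  Palindromic (3 + u * 4) (1 + v * 4) → ppl (1 + v * 4) ≤ suc (ppl (3 + u * 4))
ppl-palindrome-step[3+4u,1+4v] {u} {v} rec i<n P = begin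
  ppl (1 + v * 4)            ≡⟨ ppl[1+4q] v ⟩
  suc (ppl v)                ≤⟨ s≤s (ppl-palindrome-step-inner (rec (q<1+q*4 v)) u<v P′) ⟩
  2 + ppl (suc u)            ≡⟨ cong suc (ppl[3+4q] u) ⟨
  suc (ppl (3 + u * 4))      ∎
  where
  open ≤-Reasoning
  u<v = quot-mono-< {c = 3} (s≤s z≤n) i<n
  regroup : ∀ u v → (3 + u * 4) + (1 + v * 4) ≡ (u + suc v) * 4
  regroup = solve-∀
  P′ = Palindromic-desubstitute {u = u} {suc v} ≤-refl (regroup u v) P

ppl-palindrome-step : ∀ n → PalindromeStep n
ppl-palindrome-step = <-rec _ step
  where
  step : ∀ n → PalindromeStepBelow n → PalindromeStep n
  step n rec {i} i<n P with lastDigit i | lastDigit n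
  ... | ends0 u | ends0 v = ppl-palindrome-step[4u,4v] {u} {v} rec i<n P
  ... | ends1 u | ends3 v = ppl-palindrome-step[1+4u,3+4v] {u} {v} rec i<n P
  ... | ends2 u | ends2 v = ppl-palindrome-step[2+4u,2+4v] {u} {v} rec i<n P
  ... | ends3 u | ends1 v = ppl-palindrome-step[3+4u,1+4v] {u} {v} rec i<n P
  ... | ends0 u | ends2 v = ⊥-elim (¬Palindromic-centred-at-odd {m = u + v} i<n (regroup u v) P)
    where
    regroup : ∀ u v → u * 4 + (2 + v * 4) ≡ 2 + (u + v) * 4
    regroup = solve-∀
  ... | ends1 u | ends1 v = ⊥-elim (¬Palindromic-centred-at-odd {m = u + v} i<n (regroup u v) P)
    where
    regroup : ∀ u v → (1 + u * 4) + (1 + v * 4) ≡ 2 + (u + v) * 4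
    regroup = solve-∀
  ... | ends2 u | ends0 v = ⊥-elim (¬Palindromic-centred-at-odd {m = u + v} i<n (regroup u v) P)
    where
    regroup : ∀ u v → (2 + u * 4) + v * 4 ≡ 2 + (u + v) * 4
    regroup = solve-∀
  ... | ends3 u | ends3 v = ⊥-elim (¬Palindromic-centred-at-odd {m = suc (u + v)} i<n (regroup u v) P)
    where
    regroup : ∀ u v → (3 + u * 4) + (3 + v * 4) ≡ 2 + suc (u + v) * 4
    regroup = solve-∀
  ... | ends0 u | ends1 v = ppl-palindrome-step-odd-gap {0} {1} {u} {v} (λ ()) i<n P
  ... | ends0 u | ends3 v = ppl-palindrome-step-odd-gap {0} {3} {u} {v} (λ ()) i<n P
  ... | ends1 u | ends0 v = ppl-palindrome-step-odd-gap {1} {0} {u} {v} (λ ()) i<n P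
  ... | ends1 u | ends2 v = ppl-palindrome-step-odd-gap {1} {2} {u} {v} (λ ()) i<n P
  ... | ends2 u | ends1 v = ppl-palindrome-step-odd-gap {2} {1} {u} {v} (λ ()) i<n P
  ... | ends2 u | ends3 v = ppl-palindrome-step-odd-gap {2} {3} {u} {v} (λ ()) i<n P
  ... | ends3 u | ends0 v = ppl-palindrome-step-odd-gap {3} {0} {u} {v} (λ ()) i<n P
  ... | ends3 u | ends2 v = ppl-palindrome-step-odd-gap {3} {2} {u} {v} (λ ()) i<n P

factor : ℕ → ℕ → List Letter
factor i zero = []
factor i (suc l) = t i ∷ factor (suc i) l

map-t-applyUpTo : ∀ (g : ℕ → ℕ) i n → (∀ x → g x ≡ i + x) → map t (applyUpTo g n) ≡ factor i n
map-t-applyUpTo g i zero _ = refl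
map-t-applyUpTo g i (suc n) g≗ = cong₂ _∷_ (cong t (trans (g≗ 0) (+-identityʳ i)))
  (map-t-applyUpTo (g ∘ suc) (suc i) n (λ x → trans (g≗ (suc x)) (+-suc i x)))

prefix≡factor : ∀ n → prefix n ≡ factor 0 n
prefix≡factor n = map-t-applyUpTo (λ x → x) 0 n (λ _ → refl)

factor-++ : ∀ i l₁ l₂ → factor i l₁ ++ factor (i + l₁) l₂ ≡ factor i (l₁ + l₂)
factor-++ i zero l₂ = cong (λ j → factor j l₂) (+-identityʳ i)
factor-++ i (suc l₁) l₂ = cong (t i ∷_) (trans (cong (λ j → factor (suc i) l₁ ++ factor j l₂) (+-suc i l₁)) (factor-++ (suc i) l₁ l₂))

length-factor : ∀ i l → length (factor i l) ≡ l
length-factor i zero = refl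
length-factor i (suc l) = cong suc (length-factor (suc i) l)

factor-split : ∀ (p rest : List Letter) i l → p ++ rest ≡ factor i l →
  ∃ λ l′ → l ≡ length p + l′ × p ≡ factor i (length p) × rest ≡ factor (i + length p) l′
factor-split [] rest i l e = l , refl , refl , trans e (cong (λ j → factor j l) (sym (+-identityʳ i)))
factor-split (x ∷ p) rest i (suc l) e with ∷-injective e
... | x≡ , e′ with factor-split p rest (suc i) l e′
...   | l′ , l≡ , p≡ , rest≡ = l′ , cong suc l≡ , cong₂ _∷_ x≡ p≡ , trans rest≡ (cong (λ j → factor j l′) (sym (+-suc i (length p))))

reversedFactor : ℕ → ℕ → List Letter
reversedFactor i zero = []
reversedFactor i (suc l) = t (i + l) ∷ reversedFactor i l

factor-∷ʳ : ∀ i l → factor i (suc l) ≡ factor i l ++ [ t (i + l) ]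
factor-∷ʳ i zero = cong (λ j → [ t j ]) (sym (+-identityʳ i))
factor-∷ʳ i (suc l) = cong (t i ∷_) (trans (factor-∷ʳ (suc i) l) (cong (λ j → factor (suc i) l ++ [ t j ]) (sym (+-suc i l))))

reverse-factor : ∀ i l → reverse (factor i l) ≡ reversedFactor i l
reverse-factor i zero = refl
reverse-factor i (suc l) = begin
  reverse (factor i (suc l))                    ≡⟨ cong reverse (factor-∷ʳ i l) ⟩
  reverse (factor i l ++ [ t (i + l) ])         ≡⟨ reverse-++ (factor i l) [ t (i + l) ] ⟩
  t (i + l) ∷ reverse (factor i l)              ≡⟨ cong (t (i + l) ∷_) (reverse-factor i l) ⟩
  reversedFactor i (suc l)                      ∎
  where open ≡-Reasoning

length-reversedFactor : ∀ i l → length (reversedFactor i l) ≡ l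
length-reversedFactor i zero = refl
length-reversedFactor i (suc l) = cong suc (length-reversedFactor i l)

lookupD-factor : ∀ i l u → u < l → lookupD a (factor i l) u ≡ t (i + u)
lookupD-factor i (suc l) zero _ = cong t (sym (+-identityʳ i))
lookupD-factor i (suc l) (suc u) (s≤s u<l) = trans (lookupD-factor (suc i) l u u<l) (cong t (sym (+-suc i u)))

lookupD-reversedFactor : ∀ i u v → lookupD a (reversedFactor i (suc (u + v))) u ≡ t (i + v)
lookupD-reversedFactor i zero v = refl
lookupD-reversedFactor i (suc u) v = lookupD-reversedFactor i u v

lookupD-ext : ∀ (xs ys : List Letter) → length xs ≡ length ys →
  (∀ u → u < length xs → lookupD a xs u ≡ lookupD a ys u) → xs ≡ ys
lookupD-ext [] [] _ _ = refl
lookupD-ext (x ∷ xs) (y ∷ ys) e h = cong₂ _∷_ (h 0 (s≤s z≤n)) (lookupD-ext xs ys (suc-injective e) (λ u u< → h (suc u) (s≤s u<)))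

mirror-offsets : ∀ i u v → (i + u) + (i + v) + 1 ≡ i + (i + suc (u + v))
mirror-offsets = solve-∀

palindrome⇒Palindromic : ∀ i l → reverse (factor i l) ≡ factor i l → Palindromic i (i + l)
palindrome⇒Palindromic i l rev≡ x y i≤x x<n e
  with m≤n⇒∃[o]m+o≡n i≤x | m≤n⇒∃[o]m+o≡n (mirror≥ {i = i} e x<n)
... | u , refl | v , refl = sym (begin
  t (i + v)                                      ≡⟨ lookupD-reversedFactor i u v ⟨
  lookupD a (reversedFactor i (suc (u + v))) u   ≡⟨ cong (λ m → lookupD a (reversedFactor i m) u) l≡ ⟨
  lookupD a (reversedFactor i l) u               ≡⟨ cong (λ w → lookupD a w u) (trans (sym (reverse-factor i l)) rev≡) ⟩
  lookupD a (factor i l) u                       ≡⟨ lookupD-factor i l u (subst (u <_) (sym l≡) (s≤s (m≤m+n u v))) ⟩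
  t (i + u)                                      ∎)
  where
  open ≡-Reasoning
  l≡ : l ≡ suc (u + v)
  l≡ = +-cancelˡ-≡ i l (suc (u + v)) (+-cancelˡ-≡ i _ _ (trans (sym e) (mirror-offsets i u v)))

Palindromic⇒palindrome : ∀ i l → Palindromic i (i + l) → reverse (factor i l) ≡ factor i l
Palindromic⇒palindrome i l P = trans (reverse-factor i l)
  (lookupD-ext (reversedFactor i l) (factor i l) (trans (length-reversedFactor i l) (sym (length-factor i l))) agree)
  where
  agree : ∀ u → u < length (reversedFactor i l) → lookupD a (reversedFactor i l) u ≡ lookupD a (factor i l) u
  agree u u< with m≤n⇒∃[o]m+o≡n (subst (u <_) (length-reversedFactor i l) u<)
  ... | v , refl = begin
    lookupD a (reversedFactor i (suc (u + v))) u  ≡⟨ lookupD-reversedFactor i u v ⟩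
    t (i + v)                                     ≡⟨ P (i + u) (i + v) (m≤m+n i u) (+-monoʳ-< i (s≤s (m≤m+n u v))) (mirror-offsets i u v) ⟨
    t (i + u)                                     ≡⟨ lookupD-factor i (suc (u + v)) u (s≤s (m≤m+n u v)) ⟨
    lookupD a (factor i (suc (u + v))) u          ∎
    where open ≡-Reasoning

ppl-concat-palindromes : ∀ (ps : List (List Letter)) i l → All IsPalindrome ps → concat ps ≡ factor i l →
  ppl (i + l) ≤ ppl i + length ps
ppl-concat-palindromes [] i zero _ _ = ≤-reflexive (trans (cong ppl (+-identityʳ i)) (sym (+-identityʳ (ppl i))))
ppl-concat-palindromes (p ∷ ps) i l ((1≤∣p∣ , rev≡) ∷ pals) e with factor-split p (concat ps) i l e
... | l′ , refl , p≡ , rest≡ = begin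
  ppl (i + (length p + l′))                 ≡⟨ cong ppl (+-assoc i (length p) l′) ⟨
  ppl (i + length p + l′)                   ≤⟨ ppl-concat-palindromes ps (i + length p) l′ pals rest≡ ⟩
  ppl (i + length p) + length ps            ≤⟨ +-monoˡ-≤ (length ps) (ppl-palindrome-step (i + length p) i<i+∣p∣ P) ⟩
  suc (ppl i) + length ps                   ≡⟨ +-suc (ppl i) (length ps) ⟨
  ppl i + length (p ∷ ps)                   ∎
  where
  open ≤-Reasoning
  i<i+∣p∣ : i < i + length p
  i<i+∣p∣ = subst (_≤ i + length p) (+-comm i 1) (+-monoʳ-≤ i 1≤∣p∣)
  P : Palindromic i (i + length p)
  P = palindrome⇒Palindromic i (length p) (subst (λ w → reverse w ≡ w) p≡ rev≡)

ppl-≤-PalFact : ∀ n j → PalFact j (prefix n) → ppl n ≤ j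
ppl-≤-PalFact n j (ps , ∣ps∣≡j , pals , e) = subst (ppl n ≤_) ∣ps∣≡j
  (ppl-concat-palindromes ps 0 n pals (trans e (prefix≡factor n)))

Factorisation⇒PalFact : ∀ {n j} → Factorisation n j → PalFact j (factor 0 n)
Factorisation⇒PalFact nil = [] , refl , [] , refl
Factorisation⇒PalFact (snoc {m} {j = j} m<n P F) with Factorisation⇒PalFact F | m≤n⇒∃[o]m+o≡n m<n
... | ps , ∣ps∣≡j , pals , e | o , refl = ps ++ [ last ] , ∣ps∣≡ , ++⁺ pals (last-pal ∷ []) , concat≡
  where
  last : List Letter
  last = factor m (suc o)
  ∣ps∣≡ : length (ps ++ [ last ]) ≡ suc j
  ∣ps∣≡ = trans (length-++ ps) (trans (+-comm (length ps) 1) (cong suc ∣ps∣≡j))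
  last-pal : IsPalindrome last
  last-pal = subst (1 ≤_) (sym (length-factor m (suc o))) (s≤s z≤n)
           , Palindromic⇒palindrome m (suc o) (subst (Palindromic m) (sym (+-suc m o)) P)
  concat≡ : concat (ps ++ [ last ]) ≡ factor 0 (suc m + o)
  concat≡ = begin
    concat (ps ++ [ last ])          ≡⟨ concat-++ ps [ last ] ⟨
    concat ps ++ concat [ last ]     ≡⟨ cong₂ _++_ e (++-identityʳ last) ⟩
    factor 0 m ++ last               ≡⟨ factor-++ 0 m (suc o) ⟩
    factor 0 (m + suc o)             ≡⟨ cong (factor 0) (+-suc m o) ⟩
    factor 0 (suc m + o)             ∎
    where open ≡-Reasoning

-- PPL_t and SP_t

prefix-factorisation : ∀ n → ∃ λ j → j ≤ ppl n × PalFact j (prefix n)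
prefix-factorisation n with factorisation n
... | j , j≤ , F = j , j≤ , subst (PalFact j) (sym (prefix≡factor n)) (Factorisation⇒PalFact F)

PPL-ppl : ∀ n → PPL n (ppl n)
PPL-ppl n with prefix-factorisation n
... | j , j≤ , F = subst (λ k → PalFact k (prefix n)) (≤-antisym j≤ (ppl-≤-PalFact n j F)) F , ppl-≤-PalFact n

PPL-unique : ∀ {n k} → PPL n k → k ≡ ppl n
PPL-unique {n} (F , least) = ≤-antisym (least (ppl n) (proj₁ (PPL-ppl n))) (ppl-≤-PalFact n _ F)

SP-sp : ∀ j → SP j (sp j)
SP-sp j = subst (PPL (sp j)) (ppl-sp j) (PPL-ppl (sp j)) , earlier
  where
  earlier : ∀ m → m < sp j → ¬ PPL m j
  earlier m m<sp P = <⇒≱ m<sp (sp-least m j (≤-reflexive (PPL-unique P)))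

-- digitsValue c w is the value (c w)₄ of the digit string c w; base4 (c ∷ w) reduces to it.
digitsValue : ℕ → List ℕ → ℕ
digitsValue = foldl (λ acc d → 4 * acc + d)

digitsValue-rep12-suc : ∀ k acc → digitsValue acc (rep12 (suc k)) ≡ 4 * (4 * digitsValue acc (rep12 k) + 1) + 2
digitsValue-rep12-suc zero acc = refl
digitsValue-rep12-suc (suc k) acc = digitsValue-rep12-suc k (4 * (4 * acc + 1) + 2)

-- Every third threshold appends the digits 12: spPair (x + 3) = 16 spPair x + 6.
spPair-digits : ∀ c k → c < 3 → spPair (3 * k + c) ≡ digitsValue c (rep12 k)
spPair-digits 0 zero _ = refl
spPair-digits 1 zero _ = refl
spPair-digits 2 zero _ = refl
spPair-digits (suc (suc (suc c))) zero (s≤s (s≤s (s≤s ())))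
spPair-digits c (suc k) c<3 = begin
  spPair (3 * suc k + c)                      ≡⟨ cong spPair (regroup k c) ⟩
  2 + suc (spPair (3 * k + c) * 4) * 4        ≡⟨ cong (λ x → 2 + suc (x * 4) * 4) (spPair-digits c k c<3) ⟩
  2 + suc (digitsValue c (rep12 k) * 4) * 4   ≡⟨ reorder (digitsValue c (rep12 k)) ⟩
  4 * (4 * digitsValue c (rep12 k) + 1) + 2   ≡⟨ digitsValue-rep12-suc k c ⟨
  digitsValue c (rep12 (suc k))               ∎
  where
  open ≡-Reasoning
  regroup : ∀ k c → 3 * suc k + c ≡ 3 + (3 * k + c)
  regroup = solve-∀
  reorder : ∀ x → 2 + suc (x * 4) * 4 ≡ 4 * (4 * x + 1) + 2
  reorder = solve-∀

SP-digits : ∀ c k → c < 3 → SP (2 + (3 * k + c)) (digitsValue c (rep12 k ++ 2 ∷ []))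
SP-digits c k c<3 = subst (SP (2 + (3 * k + c))) sp≡ (SP-sp (2 + (3 * k + c)))
  where
  open ≡-Reasoning
  reorder : ∀ x → 2 + x * 4 ≡ 4 * x + 2
  reorder = solve-∀
  sp≡ : sp (2 + (3 * k + c)) ≡ digitsValue c (rep12 k ++ 2 ∷ [])
  sp≡ = begin
    2 + spPair (3 * k + c) * 4            ≡⟨ cong (λ x → 2 + x * 4) (spPair-digits c k c<3) ⟩
    2 + digitsValue c (rep12 k) * 4       ≡⟨ reorder (digitsValue c (rep12 k)) ⟩
    4 * digitsValue c (rep12 k) + 2       ≡⟨ foldl-++ _ c (rep12 k) (2 ∷ []) ⟨
    digitsValue c (rep12 k ++ 2 ∷ [])     ∎

corollary16 : (∀ (k : ℕ) → SP (3 * k + 2) (base4 (rep12 k ++ 2 ∷ [])))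
    × ((∀ (k : ℕ) → SP (3 * suc k) (base4 (1 ∷ rep12 k ++ 2 ∷ [])))
    × (∀ (k : ℕ) → SP (3 * suc k + 1) (base4 (2 ∷ rep12 k ++ 2 ∷ []))))
corollary16 =
    (λ k → reindex (regroup₂ k) (SP-digits 0 k (s≤s z≤n)))
  , (λ k → reindex (regroup₀ k) (SP-digits 1 k (s≤s (s≤s z≤n))))
  , (λ k → reindex (regroup₁ k) (SP-digits 2 k (s≤s (s≤s (s≤s z≤n)))))
  where
  reindex : ∀ {j j′ n} → j ≡ j′ → SP j n → SP j′ n
  reindex {n = n} = subst (λ j → SP j n)
  regroup₂ : ∀ k → 2 + (3 * k + 0) ≡ 3 * k + 2
  regroup₂ = solve-∀
  regroup₀ : ∀ k → 2 + (3 * k + 1) ≡ 3 * suc k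
  regroup₀ = solve-∀
  regroup₁ : ∀ k → 2 + (3 * k + 2) ≡ 3 * suc k + 1
  regroup₁ = solve-∀
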